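{- (Completeness) For every formula $\varphi$, if $\varphi$ is $\mathrm{LC}^{\triangleright}$-valid then the sequent $\vdash\varphi$ is derivable (without cut) in the sequent calculus $\mathrm{SLC}^{\triangleright}$.
   Context: Formulae: $\varphi ::= p \mid \top \mid \bot \mid \varphi\land\varphi \mid \varphi\lor\varphi \mid \varphi\to\varphi \mid \varphi\Rightarrow\varphi \mid \triangleright\varphi$ with $p$ a propositional variable. Kripke semantics: an $\mathrm{LC}^{\triangleright}$-frame is $\langle W,R\rangle$, $W$ nonempty, $R$ transitive, converse-well-founded (no infinite $x_1Rx_2R\cdots$) and connected ($x=y$ or $xRy$ or $yRx$); a model adds a persistent valuation $\vartheta$ ($w\in\vartheta(p)$, $wRx$ imply $x\in\vartheta(p)$). With $R^{=}$ the reflexive closure: $M,w\Vdash p$ iff $w\in\vartheta(p)$; $\top,\bot,\land,\lor$ as usual; $M,w\Vdash\varphi\to\psi$ iff for all $x$ with $wR^{=}x$, $M,x\Vdash\varphi$ implies $M,x\Vdash\psi$; $M,w\Vdash\varphi\Rightarrow\psi$ iff the same for all $x$ with $wRx$; $M,w\Vdash\triangleright\varphi$ iff $M,x\Vdash\varphi$ for all $x$ with $wRx$. $\varphi$ is $\mathrm{LC}^{\triangleright}$-valid if forced at every world of every such model. The calculus $\mathrm{SLC}^{\triangleright}$: sequents $\Gamma\vdash\Delta$ with $\Gamma,\Delta$ finite sets of formulae; $\Gamma,\varphi$ means $\Gamma\cup\{\varphi\}$. Axioms: $\Gamma\vdash\top,\Delta$; $\Gamma,\varphi\vdash\varphi,\Delta$;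 $\Gamma,\bot\vdash\Delta$. Rules (premises / conclusion): ($\lor L$) $\Gamma,\varphi\vdash\Delta$ and $\Gamma,\psi\vdash\Delta$ / $\Gamma,\varphi\lor\psi\vdash\Delta$; ($\lor R$) $\Gamma\vdash\varphi,\psi,\Delta$ / $\Gamma\vdash\varphi\lor\psi,\Delta$; ($\land L$) $\Gamma,\varphi,\psi\vdash\Delta$ / $\Gamma,\varphi\land\psi\vdash\Delta$; ($\land R$) $\Gamma\vdash\varphi,\Delta$ and $\Gamma\vdash\psi,\Delta$ / $\Gamma\vdash\varphi\land\psi,\Delta$; ($\to L$) $\Gamma,\varphi\Rightarrow\psi\vdash\varphi,\Delta$ and $\Gamma,\varphi\Rightarrow\psi,\psi\vdash\Delta$ / $\Gamma,\varphi\to\psi\vdash\Delta$; ($\to R$) $\Gamma,\varphi\vdash\psi,\Delta$ and $\Gamma\vdash\varphi\Rightarrow\psi,\Delta$ / $\Gamma\vdash\varphi\to\psi,\Delta$. Step rule: the conclusion is $\Sigma_l,\triangleright\Theta,\Rightarrow\!\Gamma\vdash\Rightarrow\!\Delta,\triangleright\Phi,\Sigma_r$ where $\triangleright\Theta=\{\triangleright\theta:\theta\in\Theta\}$, $\Rightarrow\!\Gamma=\{\alpha_j\Rightarrow\beta_j\}_j$, $\Rightarrow\!\Delta=\{\varphi_1\Rightarrow\psi_1,\dots,\varphi_k\Rightarrow\psi_k\}$, $\triangleright\Phi=\{\triangleright\phi_1,\dots,\triangleright\phi_n\}$; write $\to\!\Gamma=\{\alpha_j\to\beta_j\}_j$,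 $\to\!\Delta=\{\varphi_i\to\psi_i\}_{i\le k}$ and $\to\!\Delta_{ -i}=\to\!\Delta\setminus\{\varphi_i\to\psi_i\}$. It has $k+n$ premises: for $1\le i\le k$, $\Sigma_l,\to\!\Gamma,\Theta,\triangleright\Theta,\varphi_i\Rightarrow\psi_i,\varphi_i\vdash\psi_i,\to\!\Delta_{ -i},\Phi$; for $1\le i\le n$, $\Sigma_l,\Theta,\triangleright\Theta,\to\!\Gamma,\triangleright\phi_i\vdash\to\!\Delta,\Phi$. Side conditions: $k+n\ge1$; $\bot\notin\Sigma_l$, $\top\notin\Sigma_r$ and the conclusion is not an instance of the axiom $\Gamma,\varphi\vdash\varphi,\Delta$; $\Sigma_l$ and $\Sigma_r$ contain only atomic formulae (propositional variables, $\top$, $\bot$). A derivation is a finite tree of sequents built from these rules (no cut rule) whose leaves are axioms. -}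

module Defs where

open import Data.Nat using (ℕ; suc; _+_; _≥_)
import Data.Nat as N
open import Data.List using (List; []; _∷_; _++_; map; filter; length)
open import Data.List.Membership.Propositional using (_∈_; _∉_)
open import Data.Product using (Σ; _×_; _,_)
open import Data.Sum using (_⊎_)
open import Relation.Binary.PropositionalEquality using (_≡_; refl; cong; cong₂)
open import Relation.Nullary using (¬_; Dec; yes; no; ¬?)
open import Function.Bundles using (_⇔_)

infixr 6 _∧_
infixr 5 _∨_
infixr 4 _⊃_ _⇒_

data Formula : Set where
  var : ℕ → Formula
  ⊤ ⊥ : Formula
  _∧_ _∨_ : Formula → Formula → Formula
  _⊃_ : Formula → Formula → Formula   -- intuitionistic implication  →
  _⇒_ : Formula → Formula → Formula   -- strict implication  ⇒
  ▷_ : Formula → Formula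

-- decidable equality (needed for the set difference  →Δ \ {φᵢ → ψᵢ})
private
  bin : ∀ {a b c d : Formula} (f : Formula → Formula → Formula) →
        (∀ {x y u v} → f x y ≡ f u v → x ≡ u) →
        (∀ {x y u v} → f x y ≡ f u v → y ≡ v) →
        Dec (a ≡ c) → Dec (b ≡ d) → Dec (f a b ≡ f c d)
  bin f i₁ i₂ (yes refl) (yes refl) = yes refl
  bin f i₁ i₂ (no ¬p) _ = no λ e → ¬p (i₁ e)
  bin f i₁ i₂ (yes _) (no ¬q) = no λ e → ¬q (i₂ e)

_≟_ : (x y : Formula) → Dec (x ≡ y)
var m ≟ var n with m N.≟ n
... | yes refl = yes refl
... | no ¬p = no λ { refl → ¬p refl }
⊤ ≟ ⊤ = yes refl
⊥ ≟ ⊥ = yes refl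
(a ∧ b) ≟ (c ∧ d) = bin _∧_ (λ { refl → refl }) (λ { refl → refl }) (a ≟ c) (b ≟ d)
(a ∨ b) ≟ (c ∨ d) = bin _∨_ (λ { refl → refl }) (λ { refl → refl }) (a ≟ c) (b ≟ d)
(a ⊃ b) ≟ (c ⊃ d) = bin _⊃_ (λ { refl → refl }) (λ { refl → refl }) (a ≟ c) (b ≟ d)
(a ⇒ b) ≟ (c ⇒ d) = bin _⇒_ (λ { refl → refl }) (λ { refl → refl }) (a ≟ c) (b ≟ d)
(▷ a) ≟ (▷ b) with a ≟ b
... | yes refl = yes refl
... | no ¬p = no λ { refl → ¬p refl }
var _ ≟ ⊤ = no λ ()
var _ ≟ ⊥ = no λ ()
var _ ≟ (_ ∧ _) = no λ ()
var _ ≟ (_ ∨ _) = no λ ()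
var _ ≟ (_ ⊃ _) = no λ ()
var _ ≟ (_ ⇒ _) = no λ ()
var _ ≟ (▷ _) = no λ ()
⊤ ≟ var _ = no λ ()
⊤ ≟ ⊥ = no λ ()
⊤ ≟ (_ ∧ _) = no λ ()
⊤ ≟ (_ ∨ _) = no λ ()
⊤ ≟ (_ ⊃ _) = no λ ()
⊤ ≟ (_ ⇒ _) = no λ ()
⊤ ≟ (▷ _) = no λ ()
⊥ ≟ var _ = no λ ()
⊥ ≟ ⊤ = no λ ()
⊥ ≟ (_ ∧ _) = no λ ()
⊥ ≟ (_ ∨ _) = no λ ()
⊥ ≟ (_ ⊃ _) = no λ ()
⊥ ≟ (_ ⇒ _) = no λ ()
⊥ ≟ (▷ _) = no λ ()
(_ ∧ _) ≟ var _ = no λ ()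
(_ ∧ _) ≟ ⊤ = no λ ()
(_ ∧ _) ≟ ⊥ = no λ ()
(_ ∧ _) ≟ (_ ∨ _) = no λ ()
(_ ∧ _) ≟ (_ ⊃ _) = no λ ()
(_ ∧ _) ≟ (_ ⇒ _) = no λ ()
(_ ∧ _) ≟ (▷ _) = no λ ()
(_ ∨ _) ≟ var _ = no λ ()
(_ ∨ _) ≟ ⊤ = no λ ()
(_ ∨ _) ≟ ⊥ = no λ ()
(_ ∨ _) ≟ (_ ∧ _) = no λ ()
(_ ∨ _) ≟ (_ ⊃ _) = no λ ()
(_ ∨ _) ≟ (_ ⇒ _) = no λ ()
(_ ∨ _) ≟ (▷ _) = no λ ()
(_ ⊃ _) ≟ var _ = no λ ()
(_ ⊃ _) ≟ ⊤ = no λ ()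
(_ ⊃ _) ≟ ⊥ = no λ ()
(_ ⊃ _) ≟ (_ ∧ _) = no λ ()
(_ ⊃ _) ≟ (_ ∨ _) = no λ ()
(_ ⊃ _) ≟ (_ ⇒ _) = no λ ()
(_ ⊃ _) ≟ (▷ _) = no λ ()
(_ ⇒ _) ≟ var _ = no λ ()
(_ ⇒ _) ≟ ⊤ = no λ ()
(_ ⇒ _) ≟ ⊥ = no λ ()
(_ ⇒ _) ≟ (_ ∧ _) = no λ ()
(_ ⇒ _) ≟ (_ ∨ _) = no λ ()
(_ ⇒ _) ≟ (_ ⊃ _) = no λ ()
(_ ⇒ _) ≟ (▷ _) = no λ ()
(▷ _) ≟ var _ = no λ ()
(▷ _) ≟ ⊤ = no λ ()
(▷ _) ≟ ⊥ = no λ ()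
(▷ _) ≟ (_ ∧ _) = no λ ()
(▷ _) ≟ (_ ∨ _) = no λ ()
(▷ _) ≟ (_ ⊃ _) = no λ ()
(▷ _) ≟ (_ ⇒ _) = no λ ()

record Model : Set₁ where
  field
    W          : Set
    R          : W → W → Set
    nonempty   : W
    transitive : ∀ {x y z} → R x y → R y z → R x z
    cwf        : ¬ (Σ (ℕ → W) λ f → ∀ n → R (f n) (f (suc n)))
    connected  : ∀ x y → x ≡ y ⊎ (R x y ⊎ R y x)
    V          : ℕ → W → Set
    persistent : ∀ p {w x} → V p w → R w x → V p x

module _ (M : Model) where
  open Model M

  R⁼ : W → W → Set
  R⁼ w x = w ≡ x ⊎ R w x

  data ⊤ₛ : Set where tt : ⊤ₛ
  data ⊥ₛ : Set where

  _⊩_ : W → Formula → Set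
  w ⊩ var p = V p w
  w ⊩ ⊤ = ⊤ₛ
  w ⊩ ⊥ = ⊥ₛ
  w ⊩ (φ ∧ ψ) = (w ⊩ φ) × (w ⊩ ψ)
  w ⊩ (φ ∨ ψ) = (w ⊩ φ) ⊎ (w ⊩ ψ)
  w ⊩ (φ ⊃ ψ) = ∀ x → R⁼ w x → x ⊩ φ → x ⊩ ψ
  w ⊩ (φ ⇒ ψ) = ∀ x → R w x → x ⊩ φ → x ⊩ ψ
  w ⊩ (▷ φ) = ∀ x → R w x → x ⊩ φ

Valid : Formula → Set₁
Valid φ = (M : Model) (w : Model.W M) → _⊩_ M w φ

-- Finite sets of formulae are represented by lists, considered up to
-- set equality _≈_ (same members).  "Γ , φ" = Γ ∪ {φ} is matched by
-- "L ≈ φ ∷ Γ" (Γ may or may not already contain φ).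

_≈_ : List Formula → List Formula → Set
xs ≈ ys = ∀ x → (x ∈ xs) ⇔ (x ∈ ys)

data Atomic : Formula → Set where
  var : ∀ p → Atomic (var p)
  ⊤   : Atomic ⊤
  ⊥   : Atomic ⊥

AllAtomic : List Formula → Set
AllAtomic Σ = ∀ {x} → x ∈ Σ → Atomic x

Pair : Set
Pair = Formula × Formula

imps : List Pair → List Formula
imps = map λ { (a , b) → a ⊃ b }

strs : List Pair → List Formula
strs = map λ { (a , b) → a ⇒ b }

nexts : List Formula → List Formula
nexts = map ▷_

_∖_ : List Formula → Formula → List Formula
X ∖ φ = filter (λ x → ¬? (x ≟ φ)) X

data _⊢_ : List Formula → List Formula → Set where
  ax⊤  : ∀ {L R} → ⊤ ∈ R → L ⊢ R
  axId : ∀ {L R φ} → φ ∈ L → φ ∈ R → L ⊢ R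
  ax⊥  : ∀ {L R} → ⊥ ∈ L → L ⊢ R
  ∨L : ∀ {L R Γ φ ψ} → L ≈ ((φ ∨ ψ) ∷ Γ) →
       (φ ∷ Γ) ⊢ R → (ψ ∷ Γ) ⊢ R → L ⊢ R
  ∨R : ∀ {L R Δ φ ψ} → R ≈ ((φ ∨ ψ) ∷ Δ) →
       L ⊢ (φ ∷ ψ ∷ Δ) → L ⊢ R
  ∧L : ∀ {L R Γ φ ψ} → L ≈ ((φ ∧ ψ) ∷ Γ) →
       (φ ∷ ψ ∷ Γ) ⊢ R → L ⊢ R
  ∧R : ∀ {L R Δ φ ψ} → R ≈ ((φ ∧ ψ) ∷ Δ) →
       L ⊢ (φ ∷ Δ) → L ⊢ (ψ ∷ Δ) → L ⊢ R
  ⊃L : ∀ {L R Γ φ ψ} → L ≈ ((φ ⊃ ψ) ∷ Γ) →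
       ((φ ⇒ ψ) ∷ Γ) ⊢ (φ ∷ R) → ((φ ⇒ ψ) ∷ ψ ∷ Γ) ⊢ R → L ⊢ R
  ⊃R : ∀ {L R Δ φ ψ} → R ≈ ((φ ⊃ ψ) ∷ Δ) →
       (φ ∷ L) ⊢ (ψ ∷ Δ) → L ⊢ ((φ ⇒ ψ) ∷ Δ) → L ⊢ R
  step : ∀ {L R} (Σl Θ : List Formula) (Γ : List Pair)
           (Δ : List Pair) (Φ Σr : List Formula) →
       L ≈ (Σl ++ nexts Θ ++ strs Γ) →
       R ≈ (strs Δ ++ nexts Φ ++ Σr) →
       length Δ + length Φ ≥ 1 →
       ⊥ ∉ Σl → ⊤ ∉ Σr →
       (∀ {χ} → χ ∈ L → χ ∉ R) →
       AllAtomic Σl → AllAtomic Σr →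
       (∀ {φ ψ} → (φ , ψ) ∈ Δ →
          (Σl ++ imps Γ ++ Θ ++ nexts Θ ++ (φ ⇒ ψ) ∷ φ ∷ [])
            ⊢ (ψ ∷ (imps Δ ∖ (φ ⊃ ψ)) ++ Φ)) →
       (∀ {ϕ} → ϕ ∈ Φ →
          (Σl ++ Θ ++ nexts Θ ++ imps Γ ++ (▷ ϕ) ∷ [])
            ⊢ (imps Δ ++ Φ)) →
       L ⊢ R

module Submission where

-- For any sequent L ⊢ R built from the subformula closure of a goal we
-- compute an Outcome: a derivation, or a finite chain countermodel whose
-- root forces L and refutes R.  Finite chains are LC▷-frames, so for a
-- valid goal φ the search on ⊢ φ cannot end in a countermodel.

open import Defs
open import Data.Empty using (⊥-elim)
open import Data.Fin as F using (Fin; toℕ)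
import Data.Fin.Properties as FP
open import Data.List using (List; []; _∷_; _++_; concatMap; length)
open import Data.List.Membership.Propositional using (_∈_; _∉_; find; lose)
open import Data.List.Membership.Propositional.Properties
  using (∈-++⁺ˡ; ∈-++⁺ʳ; ∈-++⁻; ∈-map⁺; ∈-map⁻; ∈-filter⁺; ∈-filter⁻; ∈-concatMap⁺; ∈-concatMap⁻)
open import Data.List.Membership.DecPropositional _≟_ using (_∈?_)
open import Data.List.Relation.Unary.All using (All; []; _∷_; lookup; tabulate)
open import Data.List.Relation.Unary.All.Properties using (++⁺; filter⁺)
open import Data.List.Relation.Unary.Any using (here; there; any?)
open import Data.Nat using (ℕ; zero; suc; _+_; _≤_; _<_; _≥_; z≤n; s≤s)
open import Data.Nat.Induction using (<-wellFounded)
open import Data.Nat.Properties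
  using (≤-refl; ≤-trans; ≤-reflexive; ≤-<-trans; <-≤-trans; <-irrefl;
         m≤m+n; m≤n+m; +-assoc; +-comm; +-monoˡ-≤; +-monoʳ-≤; +-monoˡ-<; +-monoʳ-<; module ≤-Reasoning)
open import Data.Nat.Tactic.RingSolver using (solve-∀)
open import Data.Product using (Σ; _×_; _,_; proj₁; proj₂)
open import Data.Sum using (_⊎_; inj₁; inj₂)
import Data.Sum as Sum
open import Function.Bundles using (mk⇔)
open import Induction.WellFounded using (Acc; acc)
open import Relation.Binary using (tri<; tri≈; tri>)
open import Relation.Binary.PropositionalEquality using (_≡_; refl; sym; trans; cong; cong₂)
open import Relation.Nullary using (¬_; yes; no; ¬?)

∖-⊆ : ∀ {χ x} L → x ∈ L ∖ χ → x ∈ L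
∖-⊆ {χ} L m = proj₁ (∈-filter⁻ (λ y → ¬? (y ≟ χ)) m)

∈-or-∖ : ∀ {χ x} L → x ∈ L → x ≡ χ ⊎ x ∈ L ∖ χ
∈-or-∖ {χ} {x} L m with x ≟ χ
... | yes x≡χ = inj₁ x≡χ
... | no x≢χ = inj₂ (∈-filter⁺ (λ y → ¬? (y ≟ χ)) m x≢χ)

≈-∷-∖ : ∀ {χ} L → χ ∈ L → L ≈ (χ ∷ L ∖ χ)
≈-∷-∖ {χ} L χ∈L x = mk⇔ to from
  where
  to : x ∈ L → x ∈ χ ∷ L ∖ χ
  to m with ∈-or-∖ {χ} L m
  ... | inj₁ refl = here refl
  ... | inj₂ m′ = there m′
  from : x ∈ χ ∷ L ∖ χ → x ∈ L
  from (here refl) = χ∈L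
  from (there m) = ∖-⊆ L m

restore : ∀ {P : Formula → Set} {χ} L → P χ → (∀ {x} → x ∈ L ∖ χ → P x) → ∀ {x} → x ∈ L → P x
restore {χ = χ} L pχ rest m with ∈-or-∖ {χ} L m
... | inj₁ refl = pχ
... | inj₂ m′ = rest m′

∈-first : ∀ {A : Set} {x : A} xs ys zs → x ∈ xs → x ∈ xs ++ ys ++ zs
∈-first xs ys zs m = ∈-++⁺ˡ m

∈-second : ∀ {A : Set} {x : A} xs ys zs → x ∈ ys → x ∈ xs ++ ys ++ zs
∈-second xs ys zs m = ∈-++⁺ʳ xs (∈-++⁺ˡ m)

∈-third : ∀ {A : Set} {x : A} xs ys zs → x ∈ zs → x ∈ xs ++ ys ++ zs
∈-third xs ys zs m = ∈-++⁺ʳ xs (∈-++⁺ʳ ys m)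

∈-concatMap-witness : ∀ {A B : Set} (f : A → List B) {L y} → y ∈ concatMap f L → Σ A λ x → x ∈ L × y ∈ f x
∈-concatMap-witness f m = find (∈-concatMap⁻ f m)

∈-concatMap-intro : ∀ {A B : Set} (f : A → List B) {L x y} → x ∈ L → y ∈ f x → y ∈ concatMap f L
∈-concatMap-intro f x∈L y∈fx = ∈-concatMap⁺ f (lose x∈L y∈fx)

-- a ⊃ b weighs more than a, b and a ⇒ b together, since ⊃L and ⊃R
-- replace it by a ⇒ b together with a or b.

size : Formula → ℕ
size (var _) = 1
size ⊤ = 1
size ⊥ = 1
size (a ∧ b) = suc (size a + size b)
size (a ∨ b) = suc (size a + size b)
size (a ⇒ b) = suc (size a + size b)
size (a ⊃ b) = suc (suc ((size a + size b) + (size a + size b)))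
size (▷ a) = suc (size a)

sizes : List Formula → ℕ
sizes [] = 0
sizes (x ∷ xs) = size x + sizes xs

sequentSize : List Formula → List Formula → ℕ
sequentSize L R = sizes L + sizes R

sizes-++ : ∀ xs ys → sizes (xs ++ ys) ≡ sizes xs + sizes ys
sizes-++ [] ys = refl
sizes-++ (x ∷ xs) ys = trans (cong (size x +_) (sizes-++ xs ys)) (sym (+-assoc (size x) (sizes xs) (sizes ys)))

sizes-∖-≤ : ∀ χ L → sizes (L ∖ χ) ≤ sizes L
sizes-∖-≤ χ [] = ≤-refl
sizes-∖-≤ χ (y ∷ L) with y ≟ χ
... | yes _ = ≤-trans (sizes-∖-≤ χ L) (m≤n+m _ (size y))
... | no _ = +-monoʳ-≤ (size y) (sizes-∖-≤ χ L)

sizes-∖ : ∀ {χ} L → χ ∈ L → sizes (L ∖ χ) + size χ ≤ sizes L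
sizes-∖ {χ} (y ∷ L) m with y ≟ χ
sizes-∖ {χ} (y ∷ L) (here refl) | yes _ =
  ≤-trans (≤-reflexive (+-comm (sizes (L ∖ χ)) (size χ))) (+-monoʳ-≤ (size χ) (sizes-∖-≤ χ L))
sizes-∖ {χ} (y ∷ L) (there m) | yes _ = ≤-trans (sizes-∖ L m) (m≤n+m _ (size y))
sizes-∖ {χ} (y ∷ L) (here refl) | no y≢χ = ⊥-elim (y≢χ refl)
sizes-∖ {χ} (y ∷ L) (there m) | no _ =
  ≤-trans (≤-reflexive (+-assoc (size y) (sizes (L ∖ χ)) (size χ))) (+-monoʳ-≤ (size y) (sizes-∖ L m))

-- A chain of length n has the worlds Fin n, strictly ordered by <, and a
-- persistent valuation.  Finite strict linear orders are LC▷-frames.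

record Chain (n : ℕ) : Set₁ where
  field
    V          : ℕ → Fin n → Set
    persistent : ∀ p {i j} → i F.< j → V p i → V p j
open Chain

-- There is no infinite ascending sequence in Fin n: its k-th element would
-- have index at least k.
<-converseWellFounded : ∀ {n} → ¬ (Σ (ℕ → Fin n) λ f → ∀ k → f k F.< f (suc k))
<-converseWellFounded {n} (f , ascending) = <-irrefl refl (≤-<-trans (climbs n) (FP.toℕ<n (f n)))
  where
  climbs : ∀ k → k ≤ toℕ (f k)
  climbs zero = z≤n
  climbs (suc k) = ≤-<-trans (climbs k) (ascending k)

<-connected : ∀ {n} (i j : Fin n) → i ≡ j ⊎ (i F.< j ⊎ j F.< i)
<-connected i j with FP.<-cmp i j
... | tri< i<j _ _ = inj₂ (inj₁ i<j)
... | tri≈ _ i≡j _ = inj₁ i≡j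
... | tri> _ _ j<i = inj₂ (inj₂ j<i)

chainModel : ∀ {n} → Chain (suc n) → Model
chainModel C = record
  { W = Fin _ ; R = F._<_ ; nonempty = F.zero
  ; transitive = FP.<-trans ; cwf = <-converseWellFounded ; connected = <-connected
  ; V = V C ; persistent = λ p v i<j → persistent C p i<j v }

Forces : ∀ {n} → Chain (suc n) → Fin (suc n) → Formula → Set
Forces C = _⊩_ (chainModel C)

root-R⁼ : ∀ {n} (C : Chain (suc n)) j → R⁼ (chainModel C) F.zero j
root-R⁼ C F.zero = inj₁ refl
root-R⁼ C (F.suc j) = inj₂ (s≤s z≤n)

root-var-everywhere : ∀ {n} (C : Chain (suc n)) {p} → Forces C F.zero (var p) → ∀ j → V C p j
root-var-everywhere C v F.zero = v
root-var-everywhere C v (F.suc j) = persistent C _ (s≤s z≤n) v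

empty : Chain 0
empty = record { V = λ _ () ; persistent = λ { _ {()} } }

extend : ∀ {n} (P : ℕ → Set) (C : Chain n) → (∀ p → P p → ∀ j → V C p j) → Chain (suc n)
extend {n} P C P-up = record { V = V⁺ ; persistent = persistent⁺ }
  where
  V⁺ : ℕ → Fin (suc n) → Set
  V⁺ p F.zero = P p
  V⁺ p (F.suc j) = V C p j
  persistent⁺ : ∀ p {i j} → i F.< j → V⁺ p i → V⁺ p j
  persistent⁺ p {F.zero} {F.suc j} _ v = P-up p v j
  persistent⁺ p {F.suc i} {F.suc j} (s≤s i<j) v = persistent C p i<j v

-- The old worlds of an extended chain see exactly the worlds they saw
-- before, hence force exactly the same formulae.
module Extension {n} (P : ℕ → Set) (C : Chain (suc n)) (P-up : ∀ p → P p → ∀ j → V C p j) where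

  C⁺ : Chain (suc (suc n))
  C⁺ = extend P C P-up

  private
    R⁼-shift : ∀ {j x} → R⁼ (chainModel C) j x → R⁼ (chainModel C⁺) (F.suc j) (F.suc x)
    R⁼-shift (inj₁ refl) = inj₁ refl
    R⁼-shift (inj₂ j<x) = inj₂ (s≤s j<x)

    R⁼-unshift : ∀ {j x} → R⁼ (chainModel C⁺) (F.suc j) (F.suc x) → R⁼ (chainModel C) j x
    R⁼-unshift (inj₁ e) = inj₁ (FP.suc-injective e)
    R⁼-unshift (inj₂ (s≤s j<x)) = inj₂ j<x

    root-unseen : ∀ {j} → ¬ R⁼ (chainModel C⁺) (F.suc j) F.zero
    root-unseen (inj₁ ())
    root-unseen (inj₂ ())

  shift⁻ : ∀ χ j → Forces C⁺ (F.suc j) χ → Forces C j χ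
  shift⁺ : ∀ χ j → Forces C j χ → Forces C⁺ (F.suc j) χ
  shift⁻ (var p) j f = f
  shift⁻ ⊤ j f = tt
  shift⁻ ⊥ j ()
  shift⁻ (a ∧ b) j (fa , fb) = shift⁻ a j fa , shift⁻ b j fb
  shift⁻ (a ∨ b) j (inj₁ f) = inj₁ (shift⁻ a j f)
  shift⁻ (a ∨ b) j (inj₂ f) = inj₂ (shift⁻ b j f)
  shift⁻ (a ⊃ b) j f x r fa = shift⁻ b x (f (F.suc x) (R⁼-shift r) (shift⁺ a x fa))
  shift⁻ (a ⇒ b) j f x r fa = shift⁻ b x (f (F.suc x) (s≤s r) (shift⁺ a x fa))
  shift⁻ (▷ a) j f x r = shift⁻ a x (f (F.suc x) (s≤s r))
  shift⁺ (var p) j f = f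
  shift⁺ ⊤ j f = tt
  shift⁺ ⊥ j ()
  shift⁺ (a ∧ b) j (fa , fb) = shift⁺ a j fa , shift⁺ b j fb
  shift⁺ (a ∨ b) j (inj₁ f) = inj₁ (shift⁺ a j f)
  shift⁺ (a ∨ b) j (inj₂ f) = inj₂ (shift⁺ b j f)
  shift⁺ (a ⊃ b) j f F.zero r fa = ⊥-elim (root-unseen r)
  shift⁺ (a ⊃ b) j f (F.suc x) r fa = shift⁺ b x (f x (R⁼-unshift r) (shift⁻ a x fa))
  shift⁺ (a ⇒ b) j f (F.suc x) (s≤s r) fa = shift⁺ b x (f x r (shift⁻ a x fa))
  shift⁺ (▷ a) j f (F.suc x) (s≤s r) = shift⁺ a x (f x r)

Countermodel : List Formula → List Formula → Set₁
Countermodel L R = Σ ℕ λ n → Σ (Chain (suc n)) λ C →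
  (∀ {χ} → χ ∈ L → Forces C F.zero χ) × (∀ {χ} → χ ∈ R → ¬ Forces C F.zero χ)

Outcome : List Formula → List Formula → Set₁
Outcome L R = (L ⊢ R) ⊎ Countermodel L R

∧L-outcome : ∀ {a b L R} → (a ∧ b) ∈ L → Outcome (a ∷ b ∷ L ∖ (a ∧ b)) R → Outcome L R
∧L-outcome {L = L} m (inj₁ d) = inj₁ (∧L (≈-∷-∖ L m) d)
∧L-outcome {L = L} m (inj₂ (n , C , ⊩L , ⊮R)) =
  inj₂ (n , C , restore L (⊩L (here refl) , ⊩L (there (here refl))) (λ m′ → ⊩L (there (there m′))) , ⊮R)

∨L-outcome : ∀ {a b L R} → (a ∨ b) ∈ L →
  Outcome (a ∷ L ∖ (a ∨ b)) R → Outcome (b ∷ L ∖ (a ∨ b)) R → Outcome L R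
∨L-outcome {L = L} m (inj₁ d₁) (inj₁ d₂) = inj₁ (∨L (≈-∷-∖ L m) d₁ d₂)
∨L-outcome {L = L} m (inj₂ (n , C , ⊩L , ⊮R)) _ =
  inj₂ (n , C , restore L (inj₁ (⊩L (here refl))) (λ m′ → ⊩L (there m′)) , ⊮R)
∨L-outcome {L = L} m (inj₁ _) (inj₂ (n , C , ⊩L , ⊮R)) =
  inj₂ (n , C , restore L (inj₂ (⊩L (here refl))) (λ m′ → ⊩L (there m′)) , ⊮R)

-- From the first premise the root refutes a, so a ⊃ b holds there
-- vacuously; from the second the root forces b.  Above the root, a ⇒ b.
⊃L-outcome : ∀ {a b L R} → (a ⊃ b) ∈ L →
  Outcome ((a ⇒ b) ∷ L ∖ (a ⊃ b)) (a ∷ R) → Outcome ((a ⇒ b) ∷ b ∷ L ∖ (a ⊃ b)) R → Outcome L R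
⊃L-outcome {L = L} m (inj₁ d₁) (inj₁ d₂) = inj₁ (⊃L (≈-∷-∖ L m) d₁ d₂)
⊃L-outcome {L = L} m (inj₂ (n , C , ⊩L , ⊮R)) _ =
  inj₂ (n , C , restore L a⊃b (λ m′ → ⊩L (there m′)) , (λ m′ → ⊮R (there m′)))
  where
  a⊃b : ∀ x → R⁼ (chainModel C) F.zero x → _
  a⊃b x (inj₁ refl) fa = ⊥-elim (⊮R (here refl) fa)
  a⊃b x (inj₂ r) fa = ⊩L (here refl) x r fa
⊃L-outcome {L = L} m (inj₁ _) (inj₂ (n , C , ⊩L , ⊮R)) =
  inj₂ (n , C , restore L a⊃b (λ m′ → ⊩L (there (there m′))) , ⊮R)
  where
  a⊃b : ∀ x → R⁼ (chainModel C) F.zero x → _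
  a⊃b x (inj₁ refl) fa = ⊩L (there (here refl))
  a⊃b x (inj₂ r) fa = ⊩L (here refl) x r fa

∧R-outcome : ∀ {a b L R} → (a ∧ b) ∈ R →
  Outcome L (a ∷ R ∖ (a ∧ b)) → Outcome L (b ∷ R ∖ (a ∧ b)) → Outcome L R
∧R-outcome {R = R} m (inj₁ d₁) (inj₁ d₂) = inj₁ (∧R (≈-∷-∖ R m) d₁ d₂)
∧R-outcome {R = R} m (inj₂ (n , C , ⊩L , ⊮R)) _ =
  inj₂ (n , C , ⊩L , restore R (λ f → ⊮R (here refl) (proj₁ f)) (λ m′ → ⊮R (there m′)))
∧R-outcome {R = R} m (inj₁ _) (inj₂ (n , C , ⊩L , ⊮R)) =
  inj₂ (n , C , ⊩L , restore R (λ f → ⊮R (here refl) (proj₂ f)) (λ m′ → ⊮R (there m′)))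

∨R-outcome : ∀ {a b L R} → (a ∨ b) ∈ R → Outcome L (a ∷ b ∷ R ∖ (a ∨ b)) → Outcome L R
∨R-outcome {R = R} m (inj₁ d) = inj₁ (∨R (≈-∷-∖ R m) d)
∨R-outcome {R = R} m (inj₂ (n , C , ⊩L , ⊮R)) =
  inj₂ (n , C , ⊩L , restore R (Sum.[ ⊮R (here refl) , ⊮R (there (here refl)) ]) (λ m′ → ⊮R (there (there m′))))

-- From the first premise the root forces a but not b; from the second,
-- some world above the root forces a but not b.
⊃R-outcome : ∀ {a b L R} → (a ⊃ b) ∈ R →
  Outcome (a ∷ L) (b ∷ R ∖ (a ⊃ b)) → Outcome L ((a ⇒ b) ∷ R ∖ (a ⊃ b)) → Outcome L R
⊃R-outcome {R = R} m (inj₁ d₁) (inj₁ d₂) = inj₁ (⊃R (≈-∷-∖ R m) d₁ d₂)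
⊃R-outcome {R = R} m (inj₂ (n , C , ⊩L , ⊮R)) _ =
  inj₂ (n , C , (λ m′ → ⊩L (there m′)) ,
        restore R (λ f → ⊮R (here refl) (f F.zero (inj₁ refl) (⊩L (here refl)))) (λ m′ → ⊮R (there m′)))
⊃R-outcome {R = R} m (inj₁ _) (inj₂ (n , C , ⊩L , ⊮R)) =
  inj₂ (n , C , ⊩L , restore R (λ f → ⊮R (here refl) (λ x r fa → f x (inj₂ r) fa)) (λ m′ → ⊮R (there m′)))

data Reducible : Formula → Set where
  conj : ∀ a b → Reducible (a ∧ b)
  disj : ∀ a b → Reducible (a ∨ b)
  impl : ∀ a b → Reducible (a ⊃ b)

data Irreducible : Formula → Set where
  atomic : ∀ {χ} → Atomic χ → Irreducible χ
  strict : ∀ {a b} → Irreducible (a ⇒ b)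
  next   : ∀ {a} → Irreducible (▷ a)

reducible? : ∀ χ → Reducible χ ⊎ Irreducible χ
reducible? (var p) = inj₂ (atomic (var p))
reducible? ⊤ = inj₂ (atomic ⊤)
reducible? ⊥ = inj₂ (atomic ⊥)
reducible? (a ∧ b) = inj₁ (conj a b)
reducible? (a ∨ b) = inj₁ (disj a b)
reducible? (a ⊃ b) = inj₁ (impl a b)
reducible? (a ⇒ b) = inj₂ strict
reducible? (▷ a) = inj₂ next

findReducible : ∀ L → (Σ Formula λ χ → χ ∈ L × Reducible χ) ⊎ All Irreducible L
findReducible [] = inj₂ []
findReducible (x ∷ L) with reducible? x | findReducible L
... | inj₁ r | _ = inj₁ (x , here refl , r)
... | inj₂ _ | inj₁ (χ , m , r) = inj₁ (χ , there m , r)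
... | inj₂ i | inj₂ is = inj₂ (i ∷ is)

atomOf : Formula → List Formula
atomOf (var p) = var p ∷ []
atomOf ⊤ = ⊤ ∷ []
atomOf ⊥ = ⊥ ∷ []
atomOf _ = []

bodyOf : Formula → List Formula
bodyOf (▷ a) = a ∷ []
bodyOf _ = []

strictPairOf : Formula → List Pair
strictPairOf (a ⇒ b) = (a , b) ∷ []
strictPairOf _ = []

atoms : List Formula → List Formula
atoms = concatMap atomOf

bodies : List Formula → List Formula
bodies = concatMap bodyOf

strictPairs : List Formula → List Pair
strictPairs = concatMap strictPairOf

atomOf-sound : ∀ {x y} → y ∈ atomOf x → y ≡ x × Atomic x
atomOf-sound {var p} (here refl) = refl , var p
atomOf-sound {⊤} (here refl) = refl , ⊤
atomOf-sound {⊥} (here refl) = refl , ⊥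

bodyOf-sound : ∀ {x θ} → θ ∈ bodyOf x → x ≡ ▷ θ
bodyOf-sound {▷ _} (here refl) = refl

strictPairOf-sound : ∀ {x a b} → (a , b) ∈ strictPairOf x → x ≡ (a ⇒ b)
strictPairOf-sound {_ ⇒ _} (here refl) = refl

∈-atoms⁻ : ∀ L {y} → y ∈ atoms L → y ∈ L × Atomic y
∈-atoms⁻ L m with ∈-concatMap-witness atomOf m
... | x , x∈L , y∈ with atomOf-sound {x} y∈
... | refl , a = x∈L , a

∈-atoms⁺ : ∀ {L y} → y ∈ L → Atomic y → y ∈ atoms L
∈-atoms⁺ m (var p) = ∈-concatMap-intro atomOf m (here refl)
∈-atoms⁺ m ⊤ = ∈-concatMap-intro atomOf m (here refl)
∈-atoms⁺ m ⊥ = ∈-concatMap-intro atomOf m (here refl)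

∈-bodies⁻ : ∀ L {θ} → θ ∈ bodies L → (▷ θ) ∈ L
∈-bodies⁻ L m with ∈-concatMap-witness bodyOf m
... | x , x∈L , θ∈ with bodyOf-sound {x} θ∈
... | refl = x∈L

∈-bodies⁺ : ∀ {L θ} → (▷ θ) ∈ L → θ ∈ bodies L
∈-bodies⁺ m = ∈-concatMap-intro bodyOf m (here refl)

∈-strictPairs⁻ : ∀ L {a b} → (a , b) ∈ strictPairs L → (a ⇒ b) ∈ L
∈-strictPairs⁻ L m with ∈-concatMap-witness strictPairOf m
... | x , x∈L , ab∈ with strictPairOf-sound {x} ab∈
... | refl = x∈L

∈-strictPairs⁺ : ∀ {L a b} → (a ⇒ b) ∈ L → (a , b) ∈ strictPairs L
∈-strictPairs⁺ m = ∈-concatMap-intro strictPairOf m (here refl)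

∈-nexts⁺ : ∀ {θ} Θ → θ ∈ Θ → (▷ θ) ∈ nexts Θ
∈-nexts⁺ Θ = ∈-map⁺ ▷_

∈-strs⁺ : ∀ {a b} Γ → (a , b) ∈ Γ → (a ⇒ b) ∈ strs Γ
∈-strs⁺ Γ = ∈-map⁺ _

∈-imps⁺ : ∀ {a b} Γ → (a , b) ∈ Γ → (a ⊃ b) ∈ imps Γ
∈-imps⁺ Γ = ∈-map⁺ _

module Step (L R : List Formula) (irrL : All Irreducible L) (irrR : All Irreducible R)
            (⊤∉R : ⊤ ∉ R) (⊥∉L : ⊥ ∉ L) (disjoint : ∀ {χ} → χ ∈ L → χ ∉ R) where

  Σl Θ Σr Φ : List Formula
  Σl = atoms L
  Θ = bodies L
  Σr = atoms R
  Φ = bodies R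

  Γ Δ : List Pair
  Γ = strictPairs L
  Δ = strictPairs R

  L-decomposed : ∀ {χ} → χ ∈ L → χ ∈ Σl ++ nexts Θ ++ strs Γ
  L-decomposed m with lookup irrL m
  ... | atomic a = ∈-first Σl (nexts Θ) (strs Γ) (∈-atoms⁺ m a)
  ... | next = ∈-second Σl (nexts Θ) (strs Γ) (∈-nexts⁺ Θ (∈-bodies⁺ m))
  ... | strict = ∈-third Σl (nexts Θ) (strs Γ) (∈-strs⁺ Γ (∈-strictPairs⁺ m))

  L-recomposed : ∀ {χ} → χ ∈ Σl ++ nexts Θ ++ strs Γ → χ ∈ L
  L-recomposed m with ∈-++⁻ Σl m
  ... | inj₁ m₁ = proj₁ (∈-atoms⁻ L m₁)
  ... | inj₂ m₂ with ∈-++⁻ (nexts Θ) m₂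
  ...   | inj₁ m₃ with ∈-map⁻ ▷_ m₃
  ...     | θ , θ∈Θ , refl = ∈-bodies⁻ L θ∈Θ
  L-recomposed m | inj₂ m₂ | inj₂ m₃ with ∈-map⁻ _ m₃
  ...     | (a , b) , ab∈Γ , refl = ∈-strictPairs⁻ L ab∈Γ

  R-decomposed : ∀ {χ} → χ ∈ R → χ ∈ strs Δ ++ nexts Φ ++ Σr
  R-decomposed m with lookup irrR m
  ... | atomic a = ∈-third (strs Δ) (nexts Φ) Σr (∈-atoms⁺ m a)
  ... | next = ∈-second (strs Δ) (nexts Φ) Σr (∈-nexts⁺ Φ (∈-bodies⁺ m))
  ... | strict = ∈-first (strs Δ) (nexts Φ) Σr (∈-strs⁺ Δ (∈-strictPairs⁺ m))

  R-recomposed : ∀ {χ} → χ ∈ strs Δ ++ nexts Φ ++ Σr → χ ∈ R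
  R-recomposed m with ∈-++⁻ (strs Δ) m
  ... | inj₁ m₁ with ∈-map⁻ _ m₁
  ...   | (a , b) , ab∈Δ , refl = ∈-strictPairs⁻ R ab∈Δ
  R-recomposed m | inj₂ m₂ with ∈-++⁻ (nexts Φ) m₂
  ...   | inj₁ m₃ with ∈-map⁻ ▷_ m₃
  ...     | ϕ , ϕ∈Φ , refl = ∈-bodies⁻ R ϕ∈Φ
  R-recomposed m | inj₂ m₂ | inj₂ m₃ = proj₁ (∈-atoms⁻ R m₃)

  Δ-premiseˡ Δ-premiseʳ : Formula → Formula → List Formula
  Δ-premiseˡ a b = Σl ++ imps Γ ++ Θ ++ nexts Θ ++ (a ⇒ b) ∷ a ∷ []
  Δ-premiseʳ a b = b ∷ (imps Δ ∖ (a ⊃ b)) ++ Φ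

  Φ-premiseˡ : Formula → List Formula
  Φ-premiseˡ ϕ = Σl ++ Θ ++ nexts Θ ++ imps Γ ++ (▷ ϕ) ∷ []

  Φ-premiseʳ : List Formula
  Φ-premiseʳ = imps Δ ++ Φ

  step-rule : length Δ + length Φ ≥ 1 →
    (∀ {a b} → (a , b) ∈ Δ → Δ-premiseˡ a b ⊢ Δ-premiseʳ a b) →
    (∀ {ϕ} → ϕ ∈ Φ → Φ-premiseˡ ϕ ⊢ Φ-premiseʳ) → L ⊢ R
  step-rule nonempty ⊢Δ ⊢Φ =
    step Σl Θ Γ Δ Φ Σr (λ _ → mk⇔ L-decomposed L-recomposed) (λ _ → mk⇔ R-decomposed R-recomposed)
      nonempty (λ m → ⊥∉L (proj₁ (∈-atoms⁻ L m))) (λ m → ⊤∉R (proj₁ (∈-atoms⁻ R m))) disjoint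
      (λ m → proj₂ (∈-atoms⁻ L m)) (λ m → proj₂ (∈-atoms⁻ R m)) ⊢Δ ⊢Φ

  module NewRoot {n} (C : Chain n) (Σl-up : ∀ p → var p ∈ Σl → ∀ j → V C p j) where

    C⁺ : Chain (suc n)
    C⁺ = extend (λ p → var p ∈ Σl) C Σl-up

    Above : Formula → Set
    Above χ = ∀ j → Forces C⁺ (F.suc j) χ

    AboveImplies : Formula → Formula → Set
    AboveImplies a b = ∀ j → Forces C⁺ (F.suc j) a → Forces C⁺ (F.suc j) b

    countermodel : (∀ {θ} → θ ∈ Θ → Above θ) → (∀ {a b} → (a , b) ∈ Γ → AboveImplies a b) →
      (∀ {a b} → (a , b) ∈ Δ → ¬ AboveImplies a b) → (∀ {ϕ} → ϕ ∈ Φ → ¬ Above ϕ) → Countermodel L R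
    countermodel ⊩Θ ⊩Γ ⊮Δ ⊮Φ = n , C⁺ , (λ m → root-forces (L-decomposed m)) , (λ m → root-refutes (R-decomposed m))
      where
      root-forces : ∀ {χ} → χ ∈ Σl ++ nexts Θ ++ strs Γ → Forces C⁺ F.zero χ
      root-forces m with ∈-++⁻ Σl m
      ... | inj₁ m₁ with proj₂ (∈-atoms⁻ L m₁)
      ...   | var p = m₁
      ...   | ⊤ = tt
      ...   | ⊥ = ⊥-elim (⊥∉L (proj₁ (∈-atoms⁻ L m₁)))
      root-forces m | inj₂ m₂ with ∈-++⁻ (nexts Θ) m₂
      ... | inj₁ m₃ with ∈-map⁻ ▷_ m₃
      ...   | θ , θ∈Θ , refl = λ { F.zero () ; (F.suc j) _ → ⊩Θ θ∈Θ j }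
      root-forces m | inj₂ m₂ | inj₂ m₃ with ∈-map⁻ _ m₃
      ...   | (a , b) , ab∈Γ , refl = λ { F.zero () ; (F.suc j) _ fa → ⊩Γ ab∈Γ j fa }

      root-refutes : ∀ {χ} → χ ∈ strs Δ ++ nexts Φ ++ Σr → ¬ Forces C⁺ F.zero χ
      root-refutes m f with ∈-++⁻ (strs Δ) m
      ... | inj₁ m₁ with ∈-map⁻ _ m₁
      ...   | (a , b) , ab∈Δ , refl = ⊮Δ ab∈Δ (λ j → f (F.suc j) (s≤s z≤n))
      root-refutes m f | inj₂ m₂ with ∈-++⁻ (nexts Φ) m₂
      ... | inj₁ m₃ with ∈-map⁻ ▷_ m₃
      ...   | ϕ , ϕ∈Φ , refl = ⊮Φ ϕ∈Φ (λ j → f (F.suc j) (s≤s z≤n))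
      root-refutes m f | inj₂ m₂ | inj₂ m₃ with proj₂ (∈-atoms⁻ R m₃)
      ...   | var p = disjoint (proj₁ (∈-atoms⁻ L f)) (proj₁ (∈-atoms⁻ R m₃))
      ...   | ⊤ = ⊤∉R (proj₁ (∈-atoms⁻ R m₃))
      root-refutes m () | inj₂ m₂ | inj₂ m₃ | ⊥

  no-premises : (∀ {ab} → ab ∉ Δ) → (∀ {ϕ} → ϕ ∉ Φ) → Countermodel L R
  no-premises noΔ noΦ =
    NewRoot.countermodel empty (λ _ _ ()) (λ _ ()) (λ _ ()) (λ m → ⊥-elim (noΔ m)) (λ m → ⊥-elim (noΦ m))

  lift : ∀ {k} (C : Chain (suc k)) →
    (∀ {χ} → χ ∈ Σl → Forces C F.zero χ) →
    (∀ {θ} → θ ∈ Θ → Forces C F.zero θ) →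
    (∀ {θ} → θ ∈ Θ → Forces C F.zero (▷ θ)) →
    (∀ {a b} → (a , b) ∈ Γ → Forces C F.zero (a ⊃ b)) →
    (∀ {a b} → (a , b) ∈ Δ → ¬ Forces C F.zero (a ⊃ b)) →
    (∀ {ϕ} → ϕ ∈ Φ → ¬ Forces C F.zero ϕ) → Countermodel L R
  lift C ⊩Σl ⊩Θ ⊩▷Θ ⊩Γ ⊮Δ ⊮Φ = countermodel above-Θ above-Γ above-Δ above-Φ
    where
    Σl-up : ∀ p → var p ∈ Σl → ∀ j → V C p j
    Σl-up p m = root-var-everywhere C (⊩Σl m)
    open NewRoot C Σl-up
    open Extension (λ p → var p ∈ Σl) C Σl-up using (shift⁺; shift⁻)

    above-Θ : ∀ {θ} → θ ∈ Θ → Above θ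
    above-Θ {θ} m F.zero = shift⁺ θ F.zero (⊩Θ m)
    above-Θ {θ} m (F.suc i) = shift⁺ θ (F.suc i) (⊩▷Θ m (F.suc i) (s≤s z≤n))

    above-Γ : ∀ {a b} → (a , b) ∈ Γ → AboveImplies a b
    above-Γ {a} {b} m j fa = shift⁺ b j (⊩Γ m j (root-R⁼ C j) (shift⁻ a j fa))

    above-Δ : ∀ {a b} → (a , b) ∈ Δ → ¬ AboveImplies a b
    above-Δ {a} {b} m h = ⊮Δ m (λ x _ fa → shift⁻ b x (h x (shift⁺ a x fa)))

    above-Φ : ∀ {ϕ} → ϕ ∈ Φ → ¬ Above ϕ
    above-Φ {ϕ} m h = ⊮Φ m (shift⁻ ϕ F.zero (h F.zero))

  -- A countermodel of a premise for (a , b) ∈ Δ: its root forces a but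
  -- not b, so it refutes a ⊃ b; the other implications of Δ are refuted
  -- because they occur on the right.
  Δ-countermodel : ∀ {a b} → (a , b) ∈ Δ → Countermodel (Δ-premiseˡ a b) (Δ-premiseʳ a b) → Countermodel L R
  Δ-countermodel {a} {b} ab∈Δ (_ , C , ⊩L , ⊮R) = lift C
    (λ m → ⊩L (∈-++⁺ˡ m))
    (λ m → ⊩L (∈-++⁺ʳ Σl (∈-++⁺ʳ (imps Γ) (∈-++⁺ˡ m))))
    (λ m → ⊩L (∈-++⁺ʳ Σl (∈-++⁺ʳ (imps Γ) (∈-++⁺ʳ Θ (∈-++⁺ˡ (∈-nexts⁺ Θ m))))))
    (λ m → ⊩L (∈-++⁺ʳ Σl (∈-++⁺ˡ (∈-imps⁺ Γ m))))
    refutes-Δ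
    (λ m → ⊮R (there (∈-++⁺ʳ (imps Δ ∖ (a ⊃ b)) m)))
    where
    root-a : Forces C F.zero a
    root-a = ⊩L (∈-++⁺ʳ Σl (∈-++⁺ʳ (imps Γ) (∈-++⁺ʳ Θ (∈-++⁺ʳ (nexts Θ) (there (here refl))))))

    refutes-Δ : ∀ {a′ b′} → (a′ , b′) ∈ Δ → ¬ Forces C F.zero (a′ ⊃ b′)
    refutes-Δ {a′} {b′} m f with (a′ ⊃ b′) ≟ (a ⊃ b)
    ... | yes refl = ⊮R (here refl) (f F.zero (inj₁ refl) root-a)
    ... | no ne = ⊮R (there (∈-++⁺ˡ (∈-filter⁺ (λ x → ¬? (x ≟ (a ⊃ b))) (∈-imps⁺ Δ m) ne))) f

  Φ-countermodel : ∀ {ϕ} → ϕ ∈ Φ → Countermodel (Φ-premiseˡ ϕ) Φ-premiseʳ → Countermodel L R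
  Φ-countermodel _ (_ , C , ⊩L , ⊮R) = lift C
    (λ m → ⊩L (∈-++⁺ˡ m))
    (λ m → ⊩L (∈-++⁺ʳ Σl (∈-++⁺ˡ m)))
    (λ m → ⊩L (∈-++⁺ʳ Σl (∈-++⁺ʳ Θ (∈-++⁺ˡ (∈-nexts⁺ Θ m)))))
    (λ m → ⊩L (∈-++⁺ʳ Σl (∈-++⁺ʳ Θ (∈-++⁺ʳ (nexts Θ) (∈-++⁺ˡ (∈-imps⁺ Γ m))))))
    (λ m → ⊮R (∈-++⁺ˡ (∈-imps⁺ Δ m)))
    (λ m → ⊮R (∈-++⁺ʳ (imps Δ) m))

<-by-slack : ∀ {m n} d → suc m + d ≡ n → m < n
<-by-slack {m} d refl = m≤m+n (suc m) d

shrink-left : ∀ {χ} L R newL newR → χ ∈ L → sizes newL + sizes newR < size χ →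
  sequentSize (newL ++ L ∖ χ) (newR ++ R) < sequentSize L R
shrink-left {χ} L R newL newR m lighter = begin-strict
  sizes (newL ++ L ∖ χ) + sizes (newR ++ R)   ≡⟨ cong₂ _+_ (sizes-++ newL (L ∖ χ)) (sizes-++ newR R) ⟩
  (sizes newL + sizes (L ∖ χ)) + (sizes newR + sizes R)
    ≡⟨ regroup (sizes newL) (sizes (L ∖ χ)) (sizes newR) (sizes R) ⟩
  (sizes (L ∖ χ) + (sizes newL + sizes newR)) + sizes R
    <⟨ +-monoˡ-< (sizes R) (+-monoʳ-< (sizes (L ∖ χ)) lighter) ⟩
  (sizes (L ∖ χ) + size χ) + sizes R           ≤⟨ +-monoˡ-≤ (sizes R) (sizes-∖ L m) ⟩
  sizes L + sizes R                           ∎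
  where
  open ≤-Reasoning
  regroup : ∀ nl l nr r → (nl + l) + (nr + r) ≡ (l + (nl + nr)) + r
  regroup = solve-∀

shrink-right : ∀ {χ} L R newL newR → χ ∈ R → sizes newL + sizes newR < size χ →
  sequentSize (newL ++ L) (newR ++ R ∖ χ) < sequentSize L R
shrink-right {χ} L R newL newR m lighter = begin-strict
  sizes (newL ++ L) + sizes (newR ++ R ∖ χ)   ≡⟨ cong₂ _+_ (sizes-++ newL L) (sizes-++ newR (R ∖ χ)) ⟩
  (sizes newL + sizes L) + (sizes newR + sizes (R ∖ χ))
    ≡⟨ regroup (sizes newL) (sizes L) (sizes newR) (sizes (R ∖ χ)) ⟩
  sizes L + (sizes (R ∖ χ) + (sizes newL + sizes newR))
    <⟨ +-monoʳ-< (sizes L) (+-monoʳ-< (sizes (R ∖ χ)) lighter) ⟩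
  sizes L + (sizes (R ∖ χ) + size χ)           ≤⟨ +-monoʳ-≤ (sizes L) (sizes-∖ R m) ⟩
  sizes L + sizes R                           ∎
  where
  open ≤-Reasoning
  regroup : ∀ nl l nr r → (nl + l) + (nr + r) ≡ l + (r + (nl + nr))
  regroup = solve-∀

-- The new formulae of each premise of a logical rule, measured against
-- its principal formula, whose components have sizes x and y.
module Lighter where
  conjˡ : ∀ x y → suc (x + (y + 0) + 0) + 0 ≡ suc (x + y)
  conjˡ = solve-∀
  disjˡ₁ : ∀ x y → suc (x + 0 + 0) + y ≡ suc (x + y)
  disjˡ₁ = solve-∀
  disjˡ₂ : ∀ x y → suc (y + 0 + 0) + x ≡ suc (x + y)
  disjˡ₂ = solve-∀
  implˡ₁ : ∀ x y → suc ((suc (x + y) + 0) + (x + 0)) + y ≡ suc (suc ((x + y) + (x + y)))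
  implˡ₁ = solve-∀
  implˡ₂ : ∀ x y → suc ((suc (x + y) + (y + 0)) + 0) + x ≡ suc (suc ((x + y) + (x + y)))
  implˡ₂ = solve-∀
  conjʳ₁ : ∀ x y → suc (0 + (x + 0)) + y ≡ suc (x + y)
  conjʳ₁ = solve-∀
  conjʳ₂ : ∀ x y → suc (0 + (y + 0)) + x ≡ suc (x + y)
  conjʳ₂ = solve-∀
  disjʳ : ∀ x y → suc (0 + (x + (y + 0))) + 0 ≡ suc (x + y)
  disjʳ = solve-∀
  implʳ₁ : ∀ x y → suc ((x + 0) + (y + 0)) + suc (x + y) ≡ suc (suc ((x + y) + (x + y)))
  implʳ₁ = solve-∀
  implʳ₂ : ∀ x y → suc (0 + (suc (x + y) + 0)) + (x + y) ≡ suc (suc ((x + y) + (x + y)))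
  implʳ₂ = solve-∀

-- On the left, a ⊃ b and a ⇒ b both say that a ⇒ b holds above the
-- current world, and ▷ a says itself.  Logical rules keep this knowledge;
-- each premise of the step rule gains a formula from the right side.

knowledgeOf : Formula → List Formula
knowledgeOf (a ⊃ b) = (a ⇒ b) ∷ []
knowledgeOf (a ⇒ b) = (a ⇒ b) ∷ []
knowledgeOf (▷ a) = (▷ a) ∷ []
knowledgeOf _ = []

knowledge : List Formula → List Formula
knowledge = concatMap knowledgeOf

knows : ∀ {L y x} → y ∈ L → x ∈ knowledgeOf y → x ∈ knowledge L
knows = ∈-concatMap-intro knowledgeOf

_⊑_ : List Formula → List Formula → Set
L ⊑ L′ = ∀ {x} → x ∈ knowledge L → x ∈ knowledge L′

⊑-intro : ∀ {L L′} → (∀ {y} → y ∈ L → ∀ {x} → x ∈ knowledgeOf y → x ∈ knowledge L′) → L ⊑ L′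
⊑-intro {L} tells m with ∈-concatMap-witness knowledgeOf {L} m
... | y , y∈L , x∈ = tells y∈L x∈

⊑-++ˡ : ∀ xs ys → xs ⊑ (xs ++ ys)
⊑-++ˡ xs ys = ⊑-intro {xs} {xs ++ ys} λ y∈xs → knows (∈-++⁺ˡ y∈xs)

⊑-++ʳ : ∀ xs ys → ys ⊑ (xs ++ ys)
⊑-++ʳ xs ys = ⊑-intro {ys} {xs ++ ys} λ y∈ys → knows (∈-++⁺ʳ xs y∈ys)

irreducible-tells-itself : ∀ {y x} → Irreducible y → x ∈ knowledgeOf y → x ≡ y
irreducible-tells-itself (atomic (var _)) ()
irreducible-tells-itself (atomic ⊤) ()
irreducible-tells-itself (atomic ⊥) ()
irreducible-tells-itself strict (here refl) = refl
irreducible-tells-itself next (here refl) = refl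

missing : List Formula → List Formula → ℕ
missing K [] = 0
missing K (x ∷ U) with x ∈? K
... | yes _ = missing K U
... | no _ = suc (missing K U)

missing-mono : ∀ {K K′} → (∀ {x} → x ∈ K → x ∈ K′) → ∀ U → missing K′ U ≤ missing K U
missing-mono K⊆K′ [] = z≤n
missing-mono {K} {K′} K⊆K′ (x ∷ U) with x ∈? K | x ∈? K′
... | yes _ | yes _ = missing-mono K⊆K′ U
... | yes x∈K | no x∉K′ = ⊥-elim (x∉K′ (K⊆K′ x∈K))
... | no _ | yes _ = ≤-trans (missing-mono K⊆K′ U) (m≤n+m _ 1)
... | no _ | no _ = s≤s (missing-mono K⊆K′ U)

missing-strict : ∀ {K K′} → (∀ {x} → x ∈ K → x ∈ K′) → ∀ U {y} → y ∈ U → y ∈ K′ → y ∉ K →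
  missing K′ U < missing K U
missing-strict {K} {K′} K⊆K′ (x ∷ U) y∈U y∈K′ y∉K with x ∈? K | x ∈? K′
missing-strict K⊆K′ (x ∷ U) (here refl) y∈K′ y∉K | yes x∈K | _ = ⊥-elim (y∉K x∈K)
missing-strict K⊆K′ (x ∷ U) (there y∈U) y∈K′ y∉K | yes _ | yes _ = missing-strict K⊆K′ U y∈U y∈K′ y∉K
missing-strict K⊆K′ (x ∷ U) y∈U y∈K′ y∉K | yes x∈K | no x∉K′ = ⊥-elim (x∉K′ (K⊆K′ x∈K))
missing-strict K⊆K′ (x ∷ U) y∈U y∈K′ y∉K | no _ | yes _ = s≤s (missing-mono K⊆K′ U)
missing-strict K⊆K′ (x ∷ U) (here refl) y∈K′ y∉K | no _ | no x∉K′ = ⊥-elim (x∉K′ y∈K′)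
missing-strict K⊆K′ (x ∷ U) (there y∈U) y∈K′ y∉K | no _ | no _ = s≤s (missing-strict K⊆K′ U y∈U y∈K′ y∉K)

all-or-some : ∀ {A : Set} {P : A → Set} {Q : Set₁} (xs : List A) →
  (∀ {x} → x ∈ xs → P x ⊎ Q) → (∀ {x} → x ∈ xs → P x) ⊎ Q
all-or-some [] f = inj₁ λ ()
all-or-some (x ∷ xs) f with f (here refl) | all-or-some xs (λ m → f (there m))
... | inj₂ q | _ = inj₂ q
... | inj₁ _ | inj₂ q = inj₂ q
... | inj₁ p | inj₁ ps = inj₁ λ { (here refl) → p ; (there m) → ps m }

empty-or-nonempty : ∀ {A B : Set} (xs : List A) (ys : List B) →
  ((∀ {x} → x ∉ xs) × (∀ {y} → y ∉ ys)) ⊎ length xs + length ys ≥ 1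
empty-or-nonempty [] [] = inj₁ ((λ ()) , (λ ()))
empty-or-nonempty (_ ∷ _) _ = inj₂ (s≤s z≤n)
empty-or-nonempty [] (_ ∷ _) = inj₂ (s≤s z≤n)

closure : Formula → List Formula
closure (var p) = var p ∷ []
closure ⊤ = ⊤ ∷ []
closure ⊥ = ⊥ ∷ []
closure (a ∧ b) = (a ∧ b) ∷ closure a ++ closure b
closure (a ∨ b) = (a ∨ b) ∷ closure a ++ closure b
closure (a ⊃ b) = (a ⊃ b) ∷ (a ⇒ b) ∷ closure a ++ closure b
closure (a ⇒ b) = (a ⇒ b) ∷ (a ⊃ b) ∷ closure a ++ closure b
closure (▷ a) = (▷ a) ∷ closure a

closure-self : ∀ χ → χ ∈ closure χ
closure-self (var _) = here refl
closure-self ⊤ = here refl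
closure-self ⊥ = here refl
closure-self (_ ∧ _) = here refl
closure-self (_ ∨ _) = here refl
closure-self (_ ⊃ _) = here refl
closure-self (_ ⇒ _) = here refl
closure-self (▷ _) = here refl

module Search (goal : Formula) where

  -- The formulae arising from the goal by taking components and by
  -- exchanging ⊃ and ⇒: the only formulae proof search meets.
  data InClosure : Formula → Set where
    start : InClosure goal
    ∧₁ : ∀ {a b} → InClosure (a ∧ b) → InClosure a
    ∧₂ : ∀ {a b} → InClosure (a ∧ b) → InClosure b
    ∨₁ : ∀ {a b} → InClosure (a ∨ b) → InClosure a
    ∨₂ : ∀ {a b} → InClosure (a ∨ b) → InClosure b
    ⊃₁ : ∀ {a b} → InClosure (a ⊃ b) → InClosure a
    ⊃₂ : ∀ {a b} → InClosure (a ⊃ b) → InClosure b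
    ⇒₁ : ∀ {a b} → InClosure (a ⇒ b) → InClosure a
    ⇒₂ : ∀ {a b} → InClosure (a ⇒ b) → InClosure b
    ▷₁ : ∀ {a} → InClosure (▷ a) → InClosure a
    ⊃⇒ : ∀ {a b} → InClosure (a ⊃ b) → InClosure (a ⇒ b)
    ⇒⊃ : ∀ {a b} → InClosure (a ⇒ b) → InClosure (a ⊃ b)

  Closed : List Formula → Set
  Closed = All InClosure

  closure-⊆ : ∀ {χ} → InClosure χ → ∀ {x} → x ∈ closure χ → x ∈ closure goal
  closure-⊆ start m = m
  closure-⊆ (∧₁ s) m = closure-⊆ s (there (∈-++⁺ˡ m))
  closure-⊆ (∧₂ {a} s) m = closure-⊆ s (there (∈-++⁺ʳ (closure a) m))
  closure-⊆ (∨₁ s) m = closure-⊆ s (there (∈-++⁺ˡ m))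
  closure-⊆ (∨₂ {a} s) m = closure-⊆ s (there (∈-++⁺ʳ (closure a) m))
  closure-⊆ (⊃₁ s) m = closure-⊆ s (there (there (∈-++⁺ˡ m)))
  closure-⊆ (⊃₂ {a} s) m = closure-⊆ s (there (there (∈-++⁺ʳ (closure a) m)))
  closure-⊆ (⇒₁ s) m = closure-⊆ s (there (there (∈-++⁺ˡ m)))
  closure-⊆ (⇒₂ {a} s) m = closure-⊆ s (there (there (∈-++⁺ʳ (closure a) m)))
  closure-⊆ (▷₁ s) m = closure-⊆ s (there m)
  closure-⊆ (⊃⇒ s) (here refl) = closure-⊆ s (there (here refl))
  closure-⊆ (⊃⇒ s) (there (here refl)) = closure-⊆ s (here refl)
  closure-⊆ (⊃⇒ s) (there (there m)) = closure-⊆ s (there (there m))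
  closure-⊆ (⇒⊃ s) (here refl) = closure-⊆ s (there (here refl))
  closure-⊆ (⇒⊃ s) (there (here refl)) = closure-⊆ s (here refl)
  closure-⊆ (⇒⊃ s) (there (there m)) = closure-⊆ s (there (there m))

  InClosure⇒∈ : ∀ {χ} → InClosure χ → χ ∈ closure goal
  InClosure⇒∈ {χ} s = closure-⊆ s (closure-self χ)

  unknown : List Formula → ℕ
  unknown L = missing (knowledge L) (closure goal)

  unknown-mono : ∀ {L L′} → L ⊑ L′ → unknown L′ ≤ unknown L
  unknown-mono L⊑L′ = missing-mono L⊑L′ (closure goal)

  -- On an irreducible left side only its own members are known, so a
  -- closure formula κ of the right side that becomes known is new.
  unknown-drops : ∀ {L L′ R κ} → All Irreducible L → (∀ {χ} → χ ∈ L → χ ∉ R) → L ⊑ L′ →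
    κ ∈ knowledge L′ → κ ∈ R → InClosure κ → unknown L′ < unknown L
  unknown-drops {L} {κ = κ} irrL disjoint L⊑L′ κ-known κ∈R s =
    missing-strict L⊑L′ (closure goal) (InClosure⇒∈ s) κ-known κ-unknown
    where
    κ-unknown : κ ∉ knowledge L
    κ-unknown m with ∈-concatMap-witness knowledgeOf {L} m
    ... | y , y∈L , κ∈ with irreducible-tells-itself (lookup irrL y∈L) κ∈
    ... | refl = disjoint y∈L κ∈R

  record Premise (L R L′ R′ : List Formula) : Set where
    field
      closed-left     : Closed L′
      closed-right    : Closed R′
      keeps-knowledge : L ⊑ L′
      smaller         : sequentSize L′ R′ < sequentSize L R
  open Premise

  reduce-left : ∀ {L R χ} newL newR → Closed L → Closed R → χ ∈ L →
    (InClosure χ → Closed newL) → (InClosure χ → Closed newR) →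
    (∀ {x} → x ∈ knowledgeOf χ → x ∈ knowledge newL) →
    ∀ d → suc (sizes newL + sizes newR) + d ≡ size χ → Premise L R (newL ++ L ∖ χ) (newR ++ R)
  reduce-left {L} {R} {χ} newL newR clL clR m clNewL clNewR tells d slack = record
    { closed-left = ++⁺ (clNewL (lookup clL m)) (filter⁺ (λ y → ¬? (y ≟ χ)) clL)
    ; closed-right = ++⁺ (clNewR (lookup clL m)) clR
    ; keeps-knowledge = ⊑-intro {L} {newL ++ L ∖ χ} kept
    ; smaller = shrink-left L R newL newR m (<-by-slack d slack) }
    where
    kept : ∀ {y} → y ∈ L → ∀ {x} → x ∈ knowledgeOf y → x ∈ knowledge (newL ++ L ∖ χ)
    kept y∈L x∈ with ∈-or-∖ {χ} L y∈L
    ... | inj₁ refl = ⊑-++ˡ newL (L ∖ χ) (tells x∈)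
    ... | inj₂ y∈L∖χ = knows (∈-++⁺ʳ newL y∈L∖χ) x∈

  reduce-right : ∀ {L R χ} newL newR → Closed L → Closed R → χ ∈ R →
    (InClosure χ → Closed newL) → (InClosure χ → Closed newR) →
    ∀ d → suc (sizes newL + sizes newR) + d ≡ size χ → Premise L R (newL ++ L) (newR ++ R ∖ χ)
  reduce-right {L} {R} {χ} newL newR clL clR m clNewL clNewR d slack = record
    { closed-left = ++⁺ (clNewL (lookup clR m)) clL
    ; closed-right = ++⁺ (clNewR (lookup clR m)) (filter⁺ (λ y → ¬? (y ≟ χ)) clR)
    ; keeps-knowledge = ⊑-++ʳ newL L
    ; smaller = shrink-right L R newL newR m (<-by-slack d slack) }

  SearchPremises : List Formula → List Formula → Set₁
  SearchPremises L R = ∀ {L′ R′} → Premise L R L′ R′ → Outcome L′ R′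

  SearchBelow : ℕ → Set₁
  SearchBelow n = ∀ L R → Closed L → Closed R → unknown L < n → Outcome L R

  expand-left : ∀ {L R χ} → Closed L → Closed R → χ ∈ L → Reducible χ → SearchPremises L R → Outcome L R
  expand-left clL clR m (conj a b) premise = ∧L-outcome m
    (premise (reduce-left (a ∷ b ∷ []) [] clL clR m (λ s → ∧₁ s ∷ ∧₂ s ∷ []) (λ _ → []) (λ ())
      0 (Lighter.conjˡ (size a) (size b))))
  expand-left clL clR m (disj a b) premise = ∨L-outcome m
    (premise (reduce-left (a ∷ []) [] clL clR m (λ s → ∨₁ s ∷ []) (λ _ → []) (λ ())
      (size b) (Lighter.disjˡ₁ (size a) (size b))))
    (premise (reduce-left (b ∷ []) [] clL clR m (λ s → ∨₂ s ∷ []) (λ _ → []) (λ ())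
      (size a) (Lighter.disjˡ₂ (size a) (size b))))
  expand-left clL clR m (impl a b) premise = ⊃L-outcome m
    (premise (reduce-left ((a ⇒ b) ∷ []) (a ∷ []) clL clR m (λ s → ⊃⇒ s ∷ []) (λ s → ⊃₁ s ∷ [])
      (λ { (here refl) → here refl }) (size b) (Lighter.implˡ₁ (size a) (size b))))
    (premise (reduce-left ((a ⇒ b) ∷ b ∷ []) [] clL clR m (λ s → ⊃⇒ s ∷ ⊃₂ s ∷ []) (λ _ → [])
      (λ { (here refl) → here refl }) (size a) (Lighter.implˡ₂ (size a) (size b))))

  expand-right : ∀ {L R χ} → Closed L → Closed R → χ ∈ R → Reducible χ → SearchPremises L R → Outcome L R
  expand-right clL clR m (conj a b) premise = ∧R-outcome m
    (premise (reduce-right [] (a ∷ []) clL clR m (λ _ → []) (λ s → ∧₁ s ∷ [])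
      (size b) (Lighter.conjʳ₁ (size a) (size b))))
    (premise (reduce-right [] (b ∷ []) clL clR m (λ _ → []) (λ s → ∧₂ s ∷ [])
      (size a) (Lighter.conjʳ₂ (size a) (size b))))
  expand-right clL clR m (disj a b) premise = ∨R-outcome m
    (premise (reduce-right [] (a ∷ b ∷ []) clL clR m (λ _ → []) (λ s → ∨₁ s ∷ ∨₂ s ∷ [])
      0 (Lighter.disjʳ (size a) (size b))))
  expand-right clL clR m (impl a b) premise = ⊃R-outcome m
    (premise (reduce-right (a ∷ []) (b ∷ []) clL clR m (λ s → ⊃₁ s ∷ []) (λ s → ⊃₂ s ∷ [])
      (suc (size a + size b)) (Lighter.implʳ₁ (size a) (size b))))
    (premise (reduce-right [] ((a ⇒ b) ∷ []) clL clR m (λ _ → []) (λ s → ⊃⇒ s ∷ [])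
      (size a + size b) (Lighter.implʳ₂ (size a) (size b))))

  -- An irreducible sequent that is not an axiom: the premises of the step
  -- rule know strictly more, so they are searched by the outer recursion.
  module StepSearch {n} (L R : List Formula) (clL : Closed L) (clR : Closed R)
         (irrL : All Irreducible L) (irrR : All Irreducible R)
         (⊤∉R : ⊤ ∉ R) (⊥∉L : ⊥ ∉ L) (disjoint : ∀ {χ} → χ ∈ L → χ ∉ R)
         (bound : unknown L ≤ n) (below : SearchBelow n) where

    open Step L R irrL irrR ⊤∉R ⊥∉L disjoint

    closed-Σl : Closed Σl
    closed-Σl = tabulate λ m → lookup clL (proj₁ (∈-atoms⁻ L m))

    closed-Θ : Closed Θ
    closed-Θ = tabulate λ m → ▷₁ (lookup clL (∈-bodies⁻ L m))

    closed-nexts-Θ : Closed (nexts Θ)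
    closed-nexts-Θ = tabulate λ m → case-nexts (∈-map⁻ ▷_ m)
      where
      case-nexts : ∀ {χ} → Σ Formula (λ θ → θ ∈ Θ × χ ≡ ▷ θ) → InClosure χ
      case-nexts (_ , θ∈Θ , refl) = lookup clL (∈-bodies⁻ L θ∈Θ)

    closed-imps : ∀ {S} → Closed S → Closed (imps (strictPairs S))
    closed-imps {S} clS = tabulate λ m → case-imps (∈-map⁻ _ m)
      where
      case-imps : ∀ {χ} → Σ Pair (λ ab → ab ∈ strictPairs S × χ ≡ (proj₁ ab ⊃ proj₂ ab)) → InClosure χ
      case-imps (_ , ab∈ , refl) = ⇒⊃ (lookup clS (∈-strictPairs⁻ S ab∈))

    closed-Φ : Closed Φ
    closed-Φ = tabulate λ m → ▷₁ (lookup clR (∈-bodies⁻ R m))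

    -- A step premise keeps the knowledge of L: each a ⇒ b of L reappears
    -- as a ⊃ b, each ▷ θ as itself.
    keeps : ∀ {L′} → (∀ {a b} → (a , b) ∈ Γ → (a ⊃ b) ∈ L′) → (∀ {θ} → θ ∈ Θ → (▷ θ) ∈ L′) → L ⊑ L′
    keeps {L′} has-Γ has-Θ = ⊑-intro {L} {L′} tells
      where
      tells : ∀ {y} → y ∈ L → ∀ {x} → x ∈ knowledgeOf y → x ∈ knowledge L′
      tells y∈L x∈ with lookup irrL y∈L | x∈
      ... | atomic (var _) | ()
      ... | atomic ⊤ | ()
      ... | atomic ⊥ | ()
      ... | strict | _ = knows (has-Γ (∈-strictPairs⁺ y∈L)) x∈
      ... | next | _ = knows (has-Θ (∈-bodies⁺ y∈L)) x∈

    Δ-outcome : ∀ {ab} → ab ∈ Δ →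
      (Δ-premiseˡ (proj₁ ab) (proj₂ ab) ⊢ Δ-premiseʳ (proj₁ ab) (proj₂ ab)) ⊎ Countermodel L R
    Δ-outcome {a , b} ab∈Δ =
      Sum.map₂ (Δ-countermodel ab∈Δ) (below _ _ closed-premiseˡ closed-premiseʳ (<-≤-trans learns bound))
      where
      s : InClosure (a ⇒ b)
      s = lookup clR (∈-strictPairs⁻ R ab∈Δ)

      closed-premiseˡ : Closed (Δ-premiseˡ a b)
      closed-premiseˡ = ++⁺ closed-Σl (++⁺ (closed-imps clL) (++⁺ closed-Θ (++⁺ closed-nexts-Θ (s ∷ ⇒₁ s ∷ []))))

      closed-premiseʳ : Closed (Δ-premiseʳ a b)
      closed-premiseʳ = ⇒₂ s ∷ ++⁺ (filter⁺ (λ y → ¬? (y ≟ (a ⊃ b))) (closed-imps clR)) closed-Φ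

      learns : unknown (Δ-premiseˡ a b) < unknown L
      learns = unknown-drops {L} {Δ-premiseˡ a b} irrL disjoint
        (keeps (λ m → ∈-++⁺ʳ Σl (∈-++⁺ˡ (∈-imps⁺ Γ m)))
               (λ m → ∈-++⁺ʳ Σl (∈-++⁺ʳ (imps Γ) (∈-++⁺ʳ Θ (∈-++⁺ˡ (∈-nexts⁺ Θ m))))))
        (knows {Δ-premiseˡ a b} (∈-++⁺ʳ Σl (∈-++⁺ʳ (imps Γ) (∈-++⁺ʳ Θ (∈-++⁺ʳ (nexts Θ) (here refl))))) (here refl))
        (∈-strictPairs⁻ R ab∈Δ) s

    Φ-outcome : ∀ {ϕ} → ϕ ∈ Φ → (Φ-premiseˡ ϕ ⊢ Φ-premiseʳ) ⊎ Countermodel L R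
    Φ-outcome {ϕ} ϕ∈Φ =
      Sum.map₂ (Φ-countermodel ϕ∈Φ) (below _ _ closed-premiseˡ closed-premiseʳ (<-≤-trans learns bound))
      where
      s : InClosure (▷ ϕ)
      s = lookup clR (∈-bodies⁻ R ϕ∈Φ)

      closed-premiseˡ : Closed (Φ-premiseˡ ϕ)
      closed-premiseˡ = ++⁺ closed-Σl (++⁺ closed-Θ (++⁺ closed-nexts-Θ (++⁺ (closed-imps clL) (s ∷ []))))

      closed-premiseʳ : Closed Φ-premiseʳ
      closed-premiseʳ = ++⁺ (closed-imps clR) closed-Φ

      learns : unknown (Φ-premiseˡ ϕ) < unknown L
      learns = unknown-drops {L} {Φ-premiseˡ ϕ} irrL disjoint
        (keeps (λ m → ∈-++⁺ʳ Σl (∈-++⁺ʳ Θ (∈-++⁺ʳ (nexts Θ) (∈-++⁺ˡ (∈-imps⁺ Γ m)))))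
               (λ m → ∈-++⁺ʳ Σl (∈-++⁺ʳ Θ (∈-++⁺ˡ (∈-nexts⁺ Θ m)))))
        (knows {Φ-premiseˡ ϕ} (∈-++⁺ʳ Σl (∈-++⁺ʳ Θ (∈-++⁺ʳ (nexts Θ) (∈-++⁺ʳ (imps Γ) (here refl))))) (here refl))
        (∈-bodies⁻ R ϕ∈Φ) s

    outcome : Outcome L R
    outcome with empty-or-nonempty Δ Φ
    ... | inj₁ (no-Δ , no-Φ) = inj₂ (no-premises no-Δ no-Φ)
    ... | inj₂ nonempty with all-or-some Δ Δ-outcome | all-or-some Φ Φ-outcome
    ...   | inj₁ ⊢Δ | inj₁ ⊢Φ = inj₁ (step-rule nonempty ⊢Δ ⊢Φ)
    ...   | inj₂ countermodel | _ = inj₂ countermodel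
    ...   | inj₁ _ | inj₂ countermodel = inj₂ countermodel

  expand-irreducible : ∀ {n} L R → Closed L → Closed R → All Irreducible L → All Irreducible R →
    unknown L ≤ n → SearchBelow n → Outcome L R
  expand-irreducible L R clL clR irrL irrR bound below with ⊤ ∈? R | ⊥ ∈? L | any? (_∈? R) L
  ... | yes ⊤∈R | _ | _ = inj₁ (ax⊤ ⊤∈R)
  ... | no _ | yes ⊥∈L | _ = inj₁ (ax⊥ ⊥∈L)
  ... | no _ | no _ | yes shared with find shared
  ...   | _ , χ∈L , χ∈R = inj₁ (axId χ∈L χ∈R)
  expand-irreducible L R clL clR irrL irrR bound below | no ⊤∉R | no ⊥∉L | no unshared =
    StepSearch.outcome L R clL clR irrL irrR ⊤∉R ⊥∉L (λ χ∈L χ∈R → unshared (lose χ∈L χ∈R)) bound below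

  expand : ∀ {n} L R → Closed L → Closed R → unknown L ≤ n → SearchBelow n → SearchPremises L R → Outcome L R
  expand L R clL clR bound below premise with findReducible L | findReducible R
  ... | inj₁ (_ , m , r) | _ = expand-left clL clR m r premise
  ... | inj₂ _ | inj₁ (_ , m , r) = expand-right clL clR m r premise
  ... | inj₂ irrL | inj₂ irrR = expand-irreducible L R clL clR irrL irrR bound below

  search : ∀ n → SearchBelow n → ∀ L R → Closed L → Closed R → unknown L ≤ n →
    Acc _<_ (sequentSize L R) → Outcome L R
  search n below L R clL clR bound (acc smaller-acc) = expand L R clL clR bound below premise
    where
    premise : SearchPremises L R
    premise {L′} {R′} p = search n below L′ R′ (closed-left p) (closed-right p)
      (≤-trans (unknown-mono {L} {L′} (keeps-knowledge p)) bound) (smaller-acc (smaller p))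

  decide-below : ∀ n → Acc _<_ n → ∀ L R → Closed L → Closed R → unknown L ≤ n → Outcome L R
  decide-below n (acc lower) L R clL clR bound = search n below L R clL clR bound (<-wellFounded _)
    where
    below : SearchBelow n
    below L′ R′ clL′ clR′ lt = decide-below (unknown L′) (lower lt) L′ R′ clL′ clR′ ≤-refl

  decide : ∀ L R → Closed L → Closed R → Outcome L R
  decide L R clL clR = decide-below (unknown L) (<-wellFounded _) L R clL clR ≤-refl

corollary2 : (φ : Formula) → Valid φ → [] ⊢ (φ ∷ [])
corollary2 φ valid with Search.decide φ [] (φ ∷ []) [] (Search.start ∷ [])
... | inj₁ derivation = derivation
... | inj₂ (_ , C , _ , refutes) = ⊥-elim (refutes (here refl) (valid (chainModel C) F.zero))
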